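{- Let $x$ be an ascent sequence that is a restricted growth function. Then $x$ contains the pattern $0101$ (respectively $0102$, $0120$, $0121$) if and only if $x$ contains the pattern $101$ (respectively $102$, $120$, $021$).
   Context: An ascent in an integer sequence $s_1\cdots s_m$ is an index $j$ with $s_j<s_{j+1}$; $\mathrm{asc}(s)$ is the number of ascents. An ascent sequence is a sequence $x_1x_2\cdots x_n$ of nonnegative integers with $x_1=0$ and $x_i\le 1+\mathrm{asc}(x_1\cdots x_{i-1})$ for all $i\ge 2$. A sequence $x_1\cdots x_n$ of nonnegative integers is a restricted growth function (RGF) if for every $k\ge1$, the first occurrence of $k$ (if any) is preceded by an occurrence of $k-1$. For a sequence $w$, its reduction $\mathrm{red}(w)$ is obtained by replacing the $i$-th smallest distinct letter of $w$ by $i-1$. A pattern is a sequence equal to its own reduction; a pattern such as $0101$ denotes the sequence $(0,1,0,1)$. A sequence $x$ contains a pattern $p=p_1\cdots p_k$ if there are indices $i_1<\cdots<i_k$ with $\mathrm{red}(x_{i_1}\cdots x_{i_k})=p$; otherwise $x$ avoids $p$. -}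

module Defs where

open import Data.Nat using (ℕ; zero; suc; _<_; _≤_; _<?_)
open import Data.Nat.Properties using (_≟_)
open import Data.List using (List; []; _∷_; _++_; length; filter; deduplicate; map)
open import Data.List.Membership.Propositional using (_∈_)
open import Data.List.Relation.Binary.Sublist.Propositional using (_⊆_)
open import Data.Product using (∃-syntax; _×_)
open import Relation.Binary.PropositionalEquality using (_≡_)
open import Relation.Nullary using (¬_)

ascFrom : ℕ → List ℕ → ℕ
ascFrom a [] = 0
ascFrom a (b ∷ s) with a <? b
... | Relation.Nullary.yes _ = suc (ascFrom b s)
... | Relation.Nullary.no  _ = ascFrom b s

asc : List ℕ → ℕ
asc [] = 0
asc (a ∷ s) = ascFrom a s

record IsAscentSeq (x : List ℕ) : Set where
  field
    startsZero : ∃[ rest ] (x ≡ 0 ∷ rest)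
    bounded    : ∀ (a b : ℕ) (pre suf : List ℕ) →
                 x ≡ (a ∷ pre) ++ (b ∷ suf) → b ≤ suc (asc (a ∷ pre))

-- restricted growth function: every occurrence of k+1 is preceded by an
-- occurrence of k (equivalent to the condition for the first occurrence)
IsRGF : List ℕ → Set
IsRGF x = ∀ (k : ℕ) (pre suf : List ℕ) → x ≡ pre ++ (suc k ∷ suf) → k ∈ pre

rank : List ℕ → ℕ → ℕ
rank w a = length (deduplicate _≟_ (filter (_<? a) w))

-- reduction: replace the i-th smallest distinct letter by i-1
red : List ℕ → List ℕ
red w = map (rank w) w

Contains : List ℕ → List ℕ → Set
Contains x p = ∃[ s ] (s ⊆ x × red s ≡ p)

Avoids : List ℕ → List ℕ → Set
Avoids x p = ¬ Contains x p

{-# OPTIONS --safe #-}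
module Submission where

-- The reduction of a sequence depends only on its set of
-- letters, so deleting or inserting a copy of a letter that is already present leaves the
-- ranks of all letters unchanged. Each four-letter pattern is its three-letter partner with
-- one value repeated (the 0 of 101, 102, 120 in front, the 1 of 021 before the 2). Deleting
-- the extra copy from an occurrence gives one implication in any sequence; conversely, in an
-- RGF every letter is preceded by a copy of each smaller letter, which supplies that copy.

open import Defs
open import Data.Nat using (ℕ; suc; _<_; _≤_; _<?_; z≤n; s≤s; z<s; s<s)
open import Data.Nat.Properties
  using (_≟_; ≤-refl; ≤-antisym; <-≤-trans; <-trans; <-irrefl; <⇒≱; ≮⇒≥; m≤n⇒m<n∨m≡n; ≤-pred)
open import Data.List using (List; []; _∷_; _++_; length; filter; deduplicate; map)
open import Data.List.Properties using (length-++-sucʳ; map-cong; ++-assoc)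
open import Data.List.Membership.Propositional using (_∈_; _∉_)
open import Data.List.Membership.Propositional.Properties
  using (∈-∃++; ∈-filter⁺; ∈-filter⁻; ∈-deduplicate⁺; ∈-deduplicate⁻; ∈-++⁺ˡ)
open import Data.List.Relation.Unary.Any using (here; there)
import Data.List.Relation.Unary.All as All
open import Data.List.Relation.Unary.AllPairs using (_∷_)
open import Data.List.Relation.Unary.Unique.Propositional using (Unique)
open import Data.List.Relation.Unary.Unique.DecPropositional.Properties _≟_ using (deduplicate-!)
open import Data.List.Relation.Binary.Pointwise as Pointwise using (Pointwise; []; _∷_)
open import Data.List.Relation.Binary.Sublist.Propositional
  using (_⊆_; _∷_; _∷ʳ_; ⊆-refl; ⊆-trans; from∈)
open import Data.List.Relation.Binary.Sublist.Propositional.Properties using (++⁺; ∷ˡ⁻)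
open import Data.List.Relation.Binary.Subset.Propositional using () renaming (_⊆_ to _⊆ˢ_)
open import Data.List.Relation.Binary.Subset.Propositional.Properties
  using (xs⊆x∷xs; ∷⁺ʳ; ∈-∷⁺ʳ) renaming (⊆-refl to ⊆ˢ-refl)
open import Data.Product using (∃-syntax; _×_; _,_; proj₂)
open import Data.Sum using (inj₁; inj₂)
open import Data.Empty using (⊥-elim)
open import Relation.Binary.PropositionalEquality
  using (_≡_; _≢_; refl; sym; trans; cong; subst; subst₂; _≗_; module ≡-Reasoning)
open import Relation.Nullary using (yes; no)
open import Function.Bundles using (_⇔_; mk⇔)

∈-++-∷⁻ : ∀ {ℓ} {A : Set ℓ} (pre : List A) {x z : A} {suf} → z ∈ pre ++ x ∷ suf → z ≢ x → z ∈ pre ++ suf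
∈-++-∷⁻ []        (here z≡x) z≢x = ⊥-elim (z≢x z≡x)
∈-++-∷⁻ []        (there z∈) _   = z∈
∈-++-∷⁻ (_ ∷ pre) (here z≡p) _   = here z≡p
∈-++-∷⁻ (_ ∷ pre) (there z∈) z≢x = there (∈-++-∷⁻ pre z∈ z≢x)

unique-length-≤ : ∀ {ℓ} {A : Set ℓ} {xs ys : List A} → Unique xs → xs ⊆ˢ ys → length xs ≤ length ys
unique-length-≤ {xs = []}     _             _     = z≤n
unique-length-≤ {xs = x ∷ xs} (x∉xs ∷ !xs) xs⊆ys with ∈-∃++ (xs⊆ys (here refl))
... | pre , suf , refl =
  subst (suc (length xs) ≤_) (sym (length-++-sucʳ pre x suf)) (s≤s (unique-length-≤ !xs xs⊆pre++suf))
  where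
  xs⊆pre++suf : xs ⊆ˢ pre ++ suf
  xs⊆pre++suf z∈xs = ∈-++-∷⁻ pre (xs⊆ys (there z∈xs)) (λ z≡x → All.lookup x∉xs z∈xs (sym z≡x))

unique-length-< : ∀ {ℓ} {A : Set ℓ} {xs ys : List A} {y} → Unique xs → xs ⊆ˢ ys → y ∈ ys → y ∉ xs →
                  length xs < length ys
unique-length-< !xs xs⊆ys y∈ys y∉xs =
  unique-length-≤ (All.tabulate (λ z∈xs y≡z → y∉xs (subst (_∈ _) (sym y≡z) z∈xs)) ∷ !xs)
                  (∈-∷⁺ʳ y∈ys xs⊆ys)

lettersBelow : ℕ → List ℕ → List ℕ
lettersBelow a w = deduplicate _≟_ (filter (_<? a) w)

∈-lettersBelow⁺ : ∀ {a z} w → z ∈ w → z < a → z ∈ lettersBelow a w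
∈-lettersBelow⁺ {a} w z∈w z<a = ∈-deduplicate⁺ _≟_ (∈-filter⁺ (_<? a) z∈w z<a)

∈-lettersBelow⁻ : ∀ {a z} w → z ∈ lettersBelow a w → z ∈ w × z < a
∈-lettersBelow⁻ {a} w z∈ = ∈-filter⁻ (_<? a) (∈-deduplicate⁻ _≟_ (filter (_<? a) w) z∈)

rank-mono : ∀ {s t a b} → s ⊆ˢ t → a ≤ b → rank s a ≤ rank t b
rank-mono {s} {t} s⊆t a≤b = unique-length-≤ (deduplicate-! _) below
  where
  below : lettersBelow _ s ⊆ˢ lettersBelow _ t
  below z∈ with ∈-lettersBelow⁻ s z∈
  ... | z∈s , z<a = ∈-lettersBelow⁺ t (s⊆t z∈s) (<-≤-trans z<a a≤b)

rank-strictMono : ∀ {s a b} → a ∈ s → a < b → rank s a < rank s b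
rank-strictMono {s} a∈s a<b =
  unique-length-< (deduplicate-! _) below (∈-lettersBelow⁺ s a∈s a<b)
                  (λ a∈ → <-irrefl refl (proj₂ (∈-lettersBelow⁻ s a∈)))
  where
  below : lettersBelow _ s ⊆ˢ lettersBelow _ s
  below z∈ with ∈-lettersBelow⁻ s z∈
  ... | z∈s , z<a = ∈-lettersBelow⁺ s z∈s (<-trans z<a a<b)

rank-reflects-< : ∀ {s a b} → rank s a < rank s b → a < b
rank-reflects-< {s} {a} {b} r< with a <? b
... | yes a<b = a<b
... | no  a≮b = ⊥-elim (<⇒≱ r< (rank-mono {s} ⊆ˢ-refl (≮⇒≥ a≮b)))

rank-injective : ∀ {s a b} → a ∈ s → b ∈ s → rank s a ≡ rank s b → a ≡ b
rank-injective {a = a} {b} a∈s b∈s r≡ with a <? b | b <? a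
... | yes a<b | _       = ⊥-elim (<-irrefl r≡ (rank-strictMono a∈s a<b))
... | no  _   | yes b<a = ⊥-elim (<-irrefl (sym r≡) (rank-strictMono b∈s b<a))
... | no  a≮b | no  b≮a = ≤-antisym (≮⇒≥ b≮a) (≮⇒≥ a≮b)

rank-cong : ∀ {s t} → s ⊆ˢ t → t ⊆ˢ s → rank s ≗ rank t
rank-cong s⊆t t⊆s a = ≤-antisym (rank-mono s⊆t ≤-refl) (rank-mono t⊆s ≤-refl)

-- A record rather than rank s a ≡ i, so that a and i are recovered by unification.
record HasRank (s : List ℕ) (a i : ℕ) : Set where
  constructor hasRank
  field rank≡ : rank s a ≡ i

Ranked : List ℕ → List ℕ → List ℕ → Set
Ranked s = Pointwise (HasRank s)

map≡⇒Pointwise : ∀ {A B : Set} {f : A → B} {s p} → map f s ≡ p → Pointwise (λ a i → f a ≡ i) s p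
map≡⇒Pointwise {s = []}    refl = []
map≡⇒Pointwise {s = _ ∷ _} refl = refl ∷ map≡⇒Pointwise refl

Pointwise⇒map≡ : ∀ {A B : Set} {f : A → B} {s p} → Pointwise (λ a i → f a ≡ i) s p → map f s ≡ p
Pointwise⇒map≡ []          = refl
Pointwise⇒map≡ (refl ∷ fs) = cong (_ ∷_) (Pointwise⇒map≡ fs)

red⇒Ranked : ∀ {s p} → red s ≡ p → Ranked s s p
red⇒Ranked red≡ = Pointwise.map hasRank (map≡⇒Pointwise red≡)

Ranked⇒map-rank : ∀ {s t p} → Ranked s t p → map (rank s) t ≡ p
Ranked⇒map-rank ranked = Pointwise⇒map≡ (Pointwise.map HasRank.rank≡ ranked)

ranked-< : ∀ {s a b i j} → HasRank s a i → HasRank s b j → i < j → a < b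
ranked-< {s} (hasRank ra) (hasRank rb) i<j = rank-reflects-< {s} (subst₂ _<_ (sym ra) (sym rb) i<j)

ranked-≡ : ∀ {s a b i} → a ∈ s → b ∈ s → HasRank s a i → HasRank s b i → a ≡ b
ranked-≡ a∈s b∈s (hasRank ra) (hasRank rb) = rank-injective a∈s b∈s (trans ra (sym rb))

ranked-lookup : ∀ {s t p i} → Ranked s t p → i ∈ p → ∃[ k ] (k ∈ t × HasRank s k i)
ranked-lookup (rk ∷ _)  (here refl) = _ , here refl , rk
ranked-lookup (_ ∷ rks) (there i∈p) with ranked-lookup rks i∈p
... | k , k∈t , rk = k , there k∈t , rk

contains-ranked : ∀ {x s t q} → t ⊆ x → t ⊆ˢ s → s ⊆ˢ t → Ranked s t q → Contains x q
contains-ranked {s = s} {t} {q} t⊆x t⊆s s⊆t ranked = t , t⊆x , (begin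
  red t              ≡⟨ map-cong (rank-cong t⊆s s⊆t) t ⟩
  map (rank s) t     ≡⟨ Ranked⇒map-rank ranked ⟩
  q                  ∎)
  where open ≡-Reasoning

contains-∷⁻ : ∀ {x i q} → Contains x (i ∷ q) → i ∈ q → Contains x q
contains-∷⁻ ([] , _ , ()) _
contains-∷⁻ (u ∷ t , u∷t⊆x , red≡) i∈q with red⇒Ranked red≡
... | ru ∷ rt with ranked-lookup rt i∈q
...   | k , k∈t , rk =
  contains-ranked (∷ˡ⁻ u∷t⊆x) (xs⊆x∷xs t u) (∈-∷⁺ʳ (subst (_∈ t) (sym u≡k) k∈t) ⊆ˢ-refl) rt
  where
  u≡k : u ≡ k
  u≡k = ranked-≡ (here refl) (there k∈t) ru rk

∷⊆-split : ∀ {a : ℕ} {s x} → (a ∷ s) ⊆ x → ∃[ pre ] ∃[ suf ] (x ≡ pre ++ a ∷ suf × s ⊆ suf)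
∷⊆-split (y ∷ʳ p) with ∷⊆-split p
... | pre , suf , refl , s⊆suf = y ∷ pre , suf , refl , s⊆suf
∷⊆-split (refl ∷ p) = [] , _ , refl , p

rgf-below : ∀ {x} → IsRGF x → ∀ {k m pre suf} → x ≡ pre ++ m ∷ suf → k < m → k ∈ pre
rgf-below rgf {k} {suc m} {pre} {suf} x≡ k<1+m with rgf m pre suf x≡ | m≤n⇒m<n∨m≡n (≤-pred k<1+m)
... | m∈pre | inj₂ refl = m∈pre
... | m∈pre | inj₁ k<m with ∈-∃++ m∈pre
...   | pre′ , mid , refl =
  ∈-++⁺ˡ (rgf-below rgf (trans x≡ (++-assoc pre′ (m ∷ mid) (suc m ∷ suf))) k<m)

rgf-prepend : ∀ {x} → IsRGF x → ∀ {k m s} → (m ∷ s) ⊆ x → k < m → (k ∷ m ∷ s) ⊆ x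
rgf-prepend rgf m∷s⊆x k<m with ∷⊆-split m∷s⊆x
... | pre , suf , x≡ , s⊆suf =
  subst ((_ ∷ _ ∷ _) ⊆_) (sym x≡) (++⁺ (from∈ (rgf-below rgf x≡ k<m)) (refl ∷ s⊆suf))

rgf-contains-∷⁺ : ∀ {x} → IsRGF x → ∀ {i j q} → Contains x (j ∷ q) → i < j → i ∈ q →
                  Contains x (i ∷ j ∷ q)
rgf-contains-∷⁺ rgf ([] , _ , ()) _ _
rgf-contains-∷⁺ rgf (m ∷ t , m∷t⊆x , red≡) i<j i∈q with red⇒Ranked red≡
... | rm ∷ rt with ranked-lookup rt i∈q
...   | k , k∈t , rk =
  contains-ranked (rgf-prepend rgf m∷t⊆x (ranked-< rk rm i<j))
                  (∈-∷⁺ʳ (there k∈t) ⊆ˢ-refl) (xs⊆x∷xs _ k) (rk ∷ rm ∷ rt)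

0121⇒021 : ∀ {x} → Contains x (0 ∷ 1 ∷ 2 ∷ 1 ∷ []) → Contains x (0 ∷ 2 ∷ 1 ∷ [])
0121⇒021 (s , s⊆x , red≡) with s | red⇒Ranked red≡
... | u ∷ v ∷ w ∷ z ∷ [] | ru ∷ rv ∷ rw ∷ rz ∷ [] =
  contains-ranked (⊆-trans (refl ∷ (v ∷ʳ ⊆-refl)) s⊆x)
    (∷⁺ʳ u (xs⊆x∷xs _ v)) (∷⁺ʳ u (∈-∷⁺ʳ (there (here v≡z)) ⊆ˢ-refl)) (ru ∷ rw ∷ rz ∷ [])
  where
  v≡z : v ≡ z
  v≡z = ranked-≡ (there (here refl)) (there (there (there (here refl)))) rv rz

-- The 0 of the new occurrence must precede the new 1, so it is in general another copy of a.
021⇒0121 : ∀ {x} → IsRGF x → Contains x (0 ∷ 2 ∷ 1 ∷ []) → Contains x (0 ∷ 1 ∷ 2 ∷ 1 ∷ [])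
021⇒0121 {x} rgf (s , s⊆x , red≡) with s | red⇒Ranked red≡
... | a ∷ c ∷ b ∷ [] | ra ∷ rc ∷ rb ∷ [] =
  contains-ranked abcb⊆x (∷⁺ʳ a (∈-∷⁺ʳ (there (here refl)) ⊆ˢ-refl)) (∷⁺ʳ a (xs⊆x∷xs _ b))
    (ra ∷ rb ∷ rc ∷ rb ∷ [])
  where
  bcb⊆x : (b ∷ c ∷ b ∷ []) ⊆ x
  bcb⊆x = rgf-prepend rgf (∷ˡ⁻ s⊆x) (ranked-< rb rc (s<s z<s))
  abcb⊆x : (a ∷ b ∷ c ∷ b ∷ []) ⊆ x
  abcb⊆x = rgf-prepend rgf bcb⊆x (ranked-< ra rb z<s)

lemma2p2 : (x : List ℕ) → IsAscentSeq x → IsRGF x →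
    ((Contains x (0 ∷ 1 ∷ 0 ∷ 1 ∷ []) ⇔ Contains x (1 ∷ 0 ∷ 1 ∷ []))
    × (Contains x (0 ∷ 1 ∷ 0 ∷ 2 ∷ []) ⇔ Contains x (1 ∷ 0 ∷ 2 ∷ []))
    × (Contains x (0 ∷ 1 ∷ 2 ∷ 0 ∷ []) ⇔ Contains x (1 ∷ 2 ∷ 0 ∷ []))
    × (Contains x (0 ∷ 1 ∷ 2 ∷ 1 ∷ []) ⇔ Contains x (0 ∷ 2 ∷ 1 ∷ [])))
lemma2p2 x _ rgf =
    mk⇔ (λ c → contains-∷⁻ c (there (here refl))) (λ c → rgf-contains-∷⁺ rgf c z<s (here refl))
  , mk⇔ (λ c → contains-∷⁻ c (there (here refl))) (λ c → rgf-contains-∷⁺ rgf c z<s (here refl))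
  , mk⇔ (λ c → contains-∷⁻ c (there (there (here refl)))) (λ c → rgf-contains-∷⁺ rgf c z<s (there (here refl)))
  , mk⇔ 0121⇒021 (021⇒0121 rgf)
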